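{- Let $k \ge 0$ be an integer. Suppose we are given two disjoint piles $P_1$ and $P_2$ of identical-looking coins, each of size $2^k$, and it is known that $P_1$ contains exactly one counterfeit coin and $P_2$ contains exactly one counterfeit coin (and there are no other counterfeit coins). Then there is an adaptive weighing strategy using a 5-way scale that is guaranteed to identify both counterfeit coins using at most $k+1$ weighings.
   Context: All real coins have the same weight; the two counterfeit coins have the same weight as each other, which is strictly less than that of a real coin. A weighing on the 5-way scale places the same number of coins on each of two pans. Let $d$ be (number of counterfeit coins on the left pan) minus (number of counterfeit coins on the right pan). The scale reports MUCH LESS if $d \ge 2$, LESS if $d = 1$, EQUAL if $d = 0$, MORE if $d = -1$, and MUCH MORE if $d \le -2$. A strategy is adaptive: the choice of each weighing may depend on the outcomes of the previous ones. -}

module Defs where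

open import Data.Nat using (ℕ; zero; suc; _+_; _^_)
open import Data.Integer using (ℤ; +_; -[1+_]; 0ℤ; 1ℤ; -1ℤ) renaming (_+_ to _+ℤ_)
open import Data.Fin using (Fin; zero; suc; _≟_; _↑ˡ_; _↑ʳ_)
open import Data.Bool using (Bool; true; false; if_then_else_; _∨_)
open import Data.Product using (_×_; _,_)
open import Relation.Binary.PropositionalEquality using (_≡_)
open import Relation.Nullary.Decidable using (⌊_⌋)

data Pan : Set where
  left right off : Pan

isLeft isRight : Pan → Bool
isLeft left = true
isLeft _ = false
isRight right = true
isRight _ = false

countBy : ∀ {n} → (Pan → Bool) → (Fin n → Pan) → ℕ
countBy {zero} p f = 0
countBy {suc n} p f = (if p (f zero) then 1 else 0) + countBy p (λ c → f (suc c))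

record Weighing (n : ℕ) : Set where
  constructor weighing
  field
    pan      : Fin n → Pan
    balanced : countBy isLeft pan ≡ countBy isRight pan
open Weighing public

panVal : Pan → ℤ
panVal left = 1ℤ
panVal right = -1ℤ
panVal off = 0ℤ

dValue : ∀ {n} → (Fin n → Pan) → (Fin n → Bool) → ℤ
dValue {zero} f cf = 0ℤ
dValue {suc n} f cf =
  (if cf zero then panVal (f zero) else 0ℤ) +ℤ dValue (λ c → f (suc c)) (λ c → cf (suc c))

data Outcome : Set where
  muchLess less equal more muchMore : Outcome

outcomeOf : ℤ → Outcome
outcomeOf (+ 0) = equal
outcomeOf (+ 1) = less
outcomeOf (+ suc (suc _)) = muchLess
outcomeOf -[1+ 0 ] = more
outcomeOf -[1+ suc _ ] = muchMore

weigh : ∀ {n} → Weighing n → (Fin n → Bool) → Outcome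
weigh w cf = outcomeOf (dValue (pan w) cf)

data Strategy (n : ℕ) (A : Set) : ℕ → Set where
  answer : ∀ {m} → A → Strategy n A m
  weighThen : ∀ {m} → Weighing n → (Outcome → Strategy n A m) → Strategy n A (suc m)

run : ∀ {n A m} → Strategy n A m → (Fin n → Bool) → A
run (answer a) cf = a
run (weighThen w k) cf = run (k (weigh w cf)) cf

Coin : ℕ → Set
Coin k = Fin (2 ^ k + 2 ^ k)

pile₁ : ∀ k → Fin (2 ^ k) → Coin k
pile₁ k i = i ↑ˡ (2 ^ k)

pile₂ : ∀ k → Fin (2 ^ k) → Coin k
pile₂ k j = (2 ^ k) ↑ʳ j

counterfeit : ∀ k → Fin (2 ^ k) → Fin (2 ^ k) → Coin k → Bool
counterfeit k i j c = ⌊ c ≟ pile₁ k i ⌋ ∨ ⌊ c ≟ pile₂ k j ⌋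

-- Label every coin of a pile by its k binary digits. A pan pattern on labels that sends
-- as many labels left as right is a legal weighing, and it reads panVal (g x) + panVal (h y)
-- where x and y are the labels of the two counterfeit coins. The strategy keeps the unknown
-- a pair of bit strings of lengths (m, m) or (m, m + 1), with m + 1 weighings left.
-- For (m, m) both piles are weighed by their first bit: MUCH LESS / MUCH MORE reveal both
-- first bits, any other reading says that they differ, so one of them is redundant.
-- For (m, m + 1) the first pile is weighed by x₀ and the second by y₁, but only the coins
-- with y₀ = 1: LESS / MORE reveal x₀ and y₀ = 0, MUCH LESS / MUCH MORE reveal x₀ = y₁ and
-- y₀ = 1, EQUAL gives y₀ = 1 and y₁ = not x₀. Every branch leaves, up to exchanging the
-- piles, lengths of one of the two shapes for one weighing fewer.

module Submission where

open import Defs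
open import Data.Nat using (ℕ; zero; suc; _+_; _*_; _^_)
open import Data.Integer using (ℤ; 0ℤ; 1ℤ; -1ℤ; _⊖_; -_) renaming (_+_ to _+ℤ_)
import Data.Integer.Properties as ℤ
open import Data.Fin using (Fin; zero; suc; _≟_; _↑ˡ_; _↑ʳ_; splitAt; combine; remQuot)
open import Data.Fin.Properties
  using (splitAt-↑ˡ; splitAt-↑ʳ; remQuot-combine; combine-remQuot; 2↔Bool)
open import Data.Vec.Functional using (_++_)
open import Data.Vec.Functional.Properties using (lookup-++ˡ; lookup-++ʳ)
open import Data.Bool using (Bool; true; false; not; _∨_; if_then_else_)
open import Data.Bool.Properties using (∨-identityʳ)
open import Data.Vec using (Vec; []; _∷_; head; tail)
open import Data.Product using (Σ; _×_; _,_; proj₁; proj₂; uncurry)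
open import Data.Empty using (⊥-elim)
open import Function using (_∘_; Inverse)
open import Relation.Binary.PropositionalEquality
open import Relation.Nullary using (¬_)
open import Relation.Nullary.Decidable using (⌊_⌋; ⌊⌋-map′)

sumFin : ∀ {n} → (Fin n → ℤ) → ℤ
sumFin {zero} f = 0ℤ
sumFin {suc n} f = f zero +ℤ sumFin (f ∘ suc)

sumFin-cong : ∀ {n} {f g : Fin n → ℤ} → (∀ c → f c ≡ g c) → sumFin f ≡ sumFin g
sumFin-cong {zero} f≗g = refl
sumFin-cong {suc n} f≗g = cong₂ _+ℤ_ (f≗g zero) (sumFin-cong (f≗g ∘ suc))

sumFin-↑ : ∀ a {b} (f : Fin (a + b) → ℤ) →
           sumFin f ≡ sumFin (f ∘ (_↑ˡ b)) +ℤ sumFin (f ∘ (a ↑ʳ_))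
sumFin-↑ zero f = sym (ℤ.+-identityˡ _)
sumFin-↑ (suc a) f = trans (cong (f zero +ℤ_) (sumFin-↑ a (f ∘ suc)))
                           (sym (ℤ.+-assoc (f zero) _ _))

sumFin-combine : ∀ m n (f : Fin (m * n) → ℤ) →
                 sumFin f ≡ sumFin {m} (λ i → sumFin {n} (f ∘ combine i))
sumFin-combine zero n f = refl
sumFin-combine (suc m) n f = trans (sumFin-↑ n f)
  (cong (sumFin (f ∘ (_↑ˡ m * n)) +ℤ_) (sumFin-combine m n (f ∘ (n ↑ʳ_))))

sumFin-panVal : ∀ {n} (f : Fin n → Pan) →
                sumFin (panVal ∘ f) ≡ countBy isLeft f ⊖ countBy isRight f
sumFin-panVal {zero} f = refl
sumFin-panVal {suc n} f with f zero
... | left  = trans (cong (1ℤ +ℤ_) (sumFin-panVal (f ∘ suc)))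
                    (ℤ.distribʳ-⊖-+-pos 1 (countBy isLeft (f ∘ suc)) (countBy isRight (f ∘ suc)))
... | right = trans (cong (-1ℤ +ℤ_) (sumFin-panVal (f ∘ suc)))
                    (ℤ.distribʳ-⊖-+-neg 0 (countBy isLeft (f ∘ suc)) (countBy isRight (f ∘ suc)))
... | off   = trans (ℤ.+-identityˡ _) (sumFin-panVal (f ∘ suc))

m⊖n≡0⇒m≡n : ∀ m n → m ⊖ n ≡ 0ℤ → m ≡ n
m⊖n≡0⇒m≡n m n m⊖n≡0 =
  ℤ.+-injective (ℤ.i-j≡0⇒i≡j _ _ (trans (ℤ.[+m]-[+n]≡m⊖n m n) m⊖n≡0))

countBy-left≡right : ∀ {n} (f : Fin n → Pan) →
                     sumFin (panVal ∘ f) ≡ 0ℤ → countBy isLeft f ≡ countBy isRight f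
countBy-left≡right f sum≡0 = m⊖n≡0⇒m≡n _ _ (trans (sym (sumFin-panVal f)) sum≡0)

dValue-cong : ∀ {n} (f : Fin n → Pan) {p q : Fin n → Bool} →
              (∀ c → p c ≡ q c) → dValue f p ≡ dValue f q
dValue-cong {zero} f p≗q = refl
dValue-cong {suc n} f p≗q =
  cong₂ _+ℤ_ (cong (λ b → if b then panVal (f zero) else 0ℤ) (p≗q zero))
             (dValue-cong (f ∘ suc) (p≗q ∘ suc))

dValue-none : ∀ {n} (f : Fin n → Pan) → dValue f (λ _ → false) ≡ 0ℤ
dValue-none {zero} f = refl
dValue-none {suc n} f = trans (ℤ.+-identityˡ _) (dValue-none (f ∘ suc))

⌊suc≟suc⌋ : ∀ {n} (c a : Fin n) → ⌊ suc c ≟ suc a ⌋ ≡ ⌊ c ≟ a ⌋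
⌊suc≟suc⌋ c a = ⌊⌋-map′ _ _ (c ≟ a)

dValue-single : ∀ {n} (f : Fin n → Pan) a → dValue f (λ c → ⌊ c ≟ a ⌋) ≡ panVal (f a)
dValue-single f zero = trans (cong (panVal (f zero) +ℤ_) (dValue-none (f ∘ suc))) (ℤ.+-identityʳ _)
dValue-single f (suc a) = trans (ℤ.+-identityˡ _)
  (trans (dValue-cong (f ∘ suc) (λ c → ⌊suc≟suc⌋ c a)) (dValue-single (f ∘ suc) a))

dValue-pair : ∀ {n} (f : Fin n → Pan) a b → ¬ a ≡ b →
              dValue f (λ c → ⌊ c ≟ a ⌋ ∨ ⌊ c ≟ b ⌋) ≡ panVal (f a) +ℤ panVal (f b)
dValue-pair f zero zero a≢b = ⊥-elim (a≢b refl)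
dValue-pair f zero (suc b) a≢b = cong (panVal (f zero) +ℤ_)
  (trans (dValue-cong (f ∘ suc) (λ c → ⌊suc≟suc⌋ c b)) (dValue-single (f ∘ suc) b))
dValue-pair f (suc a) zero a≢b = trans (cong (panVal (f zero) +ℤ_)
  (trans (dValue-cong (f ∘ suc) (λ c → trans (∨-identityʳ _) (⌊suc≟suc⌋ c a)))
         (dValue-single (f ∘ suc) a)))
  (ℤ.+-comm (panVal (f zero)) (panVal (f (suc a))))
dValue-pair f (suc a) (suc b) a≢b = trans (ℤ.+-identityˡ _)
  (trans (dValue-cong (f ∘ suc) (λ c → cong₂ _∨_ (⌊suc≟suc⌋ c a) (⌊suc≟suc⌋ c b)))
         (dValue-pair (f ∘ suc) a b (a≢b ∘ cong suc)))

↑ˡ≢↑ʳ : ∀ {a b} (i : Fin a) (j : Fin b) → ¬ i ↑ˡ b ≡ a ↑ʳ j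
↑ˡ≢↑ʳ {a} {b} i j eq
  with trans (sym (splitAt-↑ˡ a i b)) (trans (cong (splitAt a) eq) (splitAt-↑ʳ a b j))
... | ()

twoCounterfeits : ∀ {a b} → Fin a → Fin b → Fin (a + b) → Bool
twoCounterfeits {a} {b} i j c = ⌊ c ≟ i ↑ˡ b ⌋ ∨ ⌊ c ≟ a ↑ʳ j ⌋

pileWeighing : ∀ {a b} (g : Fin a → Pan) (h : Fin b → Pan) →
               sumFin (panVal ∘ g) ≡ 0ℤ → sumFin (panVal ∘ h) ≡ 0ℤ → Weighing (a + b)
pileWeighing {a} {b} g h g≡0 h≡0 =
  weighing (g ++ h) (countBy-left≡right (g ++ h) (begin
  sumFin (panVal ∘ (g ++ h))
    ≡⟨ sumFin-↑ a _ ⟩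
  sumFin (panVal ∘ (g ++ h) ∘ (_↑ˡ b)) +ℤ sumFin (panVal ∘ (g ++ h) ∘ (a ↑ʳ_))
    ≡⟨ cong₂ _+ℤ_ (sumFin-cong (cong panVal ∘ lookup-++ˡ g h))
                  (sumFin-cong (cong panVal ∘ lookup-++ʳ g h)) ⟩
  sumFin (panVal ∘ g) +ℤ sumFin (panVal ∘ h)
    ≡⟨ cong₂ _+ℤ_ g≡0 h≡0 ⟩
  0ℤ ∎))
  where open ≡-Reasoning

weigh-pileWeighing : ∀ {a b} g h g≡0 h≡0 (i : Fin a) (j : Fin b) →
  weigh (pileWeighing g h g≡0 h≡0) (twoCounterfeits i j)
    ≡ outcomeOf (panVal (g i) +ℤ panVal (h j))
weigh-pileWeighing g h _ _ i j = cong outcomeOf (trans (dValue-pair (g ++ h) _ _ (↑ˡ≢↑ʳ i j))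
  (cong₂ _+ℤ_ (cong panVal (lookup-++ˡ g h i)) (cong panVal (lookup-++ʳ g h j))))

sumBits : ∀ {m} → (Vec Bool m → ℤ) → ℤ
sumBits {zero} f = f []
sumBits {suc m} f = sumBits (f ∘ (false ∷_)) +ℤ sumBits (f ∘ (true ∷_))

sumBits-neg : ∀ {m} (f : Vec Bool m → ℤ) → sumBits (-_ ∘ f) ≡ - sumBits f
sumBits-neg {zero} f = refl
sumBits-neg {suc m} f =
  trans (cong₂ _+ℤ_ (sumBits-neg (f ∘ (false ∷_))) (sumBits-neg (f ∘ (true ∷_))))
  (sym (ℤ.neg-distrib-+ (sumBits (f ∘ (false ∷_))) (sumBits (f ∘ (true ∷_)))))

record Balanced {m} (g : Vec Bool m → Pan) : Set where
  constructor mkBalanced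
  field sumBits-panVal≡0 : sumBits (panVal ∘ g) ≡ 0ℤ

side : Bool → Pan
side false = left
side true = right

byHead : ∀ {m} → Vec Bool (suc m) → Pan
byHead = side ∘ head

branch : ∀ {m} → (Vec Bool m → Pan) → (Vec Bool m → Pan) → Vec Bool (suc m) → Pan
branch g h (false ∷ v) = g v
branch g h (true ∷ v) = h v

sumBits-off : ∀ {m} → sumBits {m} (λ _ → panVal off) ≡ 0ℤ
sumBits-off {zero} = refl
sumBits-off {suc m} = cong₂ _+ℤ_ (sumBits-off {m}) (sumBits-off {m})

balanced-off : ∀ {m} → Balanced {m} (λ _ → off)
balanced-off {m} = mkBalanced (sumBits-off {m})

balanced-byHead : ∀ {m} → Balanced {suc m} byHead
balanced-byHead {m} = mkBalanced (trans (cong (ones +ℤ_) (sumBits-neg {m} (λ _ → 1ℤ)))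
                                        (ℤ.+-inverseʳ ones))
  where
  ones : ℤ
  ones = sumBits {m} (λ _ → 1ℤ)

balanced-branch : ∀ {m} {g h : Vec Bool m → Pan} →
                  Balanced g → Balanced h → Balanced (branch g h)
balanced-branch (mkBalanced g≡0) (mkBalanced h≡0) = mkBalanced (cong₂ _+ℤ_ g≡0 h≡0)

balanced-∘tail : ∀ {m} {g : Vec Bool m → Pan} → Balanced g → Balanced (g ∘ tail)
balanced-∘tail (mkBalanced g≡0) = mkBalanced (cong₂ _+ℤ_ g≡0 g≡0)

bitToFin : Bool → Fin 2
bitToFin = Inverse.from 2↔Bool

finToBit : Fin 2 → Bool
finToBit = Inverse.to 2↔Bool

toBits : ∀ k → Fin (2 ^ k) → Vec Bool k
toBits zero c = []
toBits (suc k) c = finToBit (proj₁ (remQuot {2} (2 ^ k) c))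
                 ∷ toBits k (proj₂ (remQuot {2} (2 ^ k) c))

fromBits : ∀ k → Vec Bool k → Fin (2 ^ k)
fromBits zero [] = zero
fromBits (suc k) (b ∷ v) = combine (bitToFin b) (fromBits k v)

fromBits-toBits : ∀ k c → fromBits k (toBits k c) ≡ c
fromBits-toBits zero zero = refl
fromBits-toBits (suc k) c = begin
  combine (bitToFin (finToBit b)) (fromBits k (toBits k c′))
    ≡⟨ cong₂ combine (Inverse.strictlyInverseʳ 2↔Bool b) (fromBits-toBits k c′) ⟩
  combine b c′
    ≡⟨ combine-remQuot {2} (2 ^ k) c ⟩
  c ∎
  where
  open ≡-Reasoning
  b = proj₁ (remQuot {2} (2 ^ k) c)
  c′ = proj₂ (remQuot {2} (2 ^ k) c)

toBits-combine : ∀ k b c → toBits (suc k) (combine {n = 2 ^ k} b c) ≡ finToBit b ∷ toBits k c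
toBits-combine k b c = cong (λ (b , c) → finToBit b ∷ toBits k c) (remQuot-combine b c)

sumFin-toBits : ∀ k (φ : Vec Bool k → ℤ) → sumFin (φ ∘ toBits k) ≡ sumBits φ
sumFin-toBits zero φ = ℤ.+-identityʳ _
sumFin-toBits (suc k) φ = begin
  sumFin (φ ∘ toBits (suc k))
    ≡⟨ sumFin-combine 2 (2 ^ k) _ ⟩
  sumFin {2} (λ b → sumFin (λ c → φ (toBits (suc k) (combine {n = 2 ^ k} b c))))
    ≡⟨ sumFin-cong (λ b → sumFin-cong (cong φ ∘ toBits-combine k b)) ⟩
  sumFin {2} (λ b → sumFin (φ ∘ (finToBit b ∷_) ∘ toBits k))
    ≡⟨ sumFin-cong (λ b → sumFin-toBits k (φ ∘ (finToBit b ∷_))) ⟩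
  sumFin {2} (λ b → sumBits (φ ∘ (finToBit b ∷_)))
    ≡⟨ cong (sumBits (φ ∘ (false ∷_)) +ℤ_) (ℤ.+-identityʳ _) ⟩
  sumBits φ ∎
  where open ≡-Reasoning

-- W is the set of possible worlds and cf w the counterfeit coins in world w; a strategy only
-- has to find the two labels, since every pair of balanced label patterns is a weighing.
record Labelling {n} {W : Set} (cf : W → Fin n → Bool) (a b : ℕ) : Set where
  field
    label₁ : W → Vec Bool a
    label₂ : W → Vec Bool b
    weighingBy : (g : Vec Bool a → Pan) (h : Vec Bool b → Pan) →
                 Balanced g → Balanced h → Weighing n
    weigh-weighingBy : ∀ g h (g≡0 : Balanced g) (h≡0 : Balanced h) w →
      weigh (weighingBy g h g≡0 h≡0) (cf w)
        ≡ outcomeOf (panVal (g (label₁ w)) +ℤ panVal (h (label₂ w)))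
open Labelling

module _ {n} {W : Set} {cf : W → Fin n → Bool} where

  swap : ∀ {a b} → Labelling cf a b → Labelling cf b a
  swap L = record
    { label₁ = label₂ L
    ; label₂ = label₁ L
    ; weighingBy = λ g h g≡0 h≡0 → weighingBy L h g h≡0 g≡0
    ; weigh-weighingBy = λ g h g≡0 h≡0 w → trans (weigh-weighingBy L h g h≡0 g≡0 w)
        (cong outcomeOf (ℤ.+-comm (panVal (h (label₁ L w))) (panVal (g (label₂ L w)))))
    }

  dropHead₁ : ∀ {a b} → Labelling cf (suc a) b → Labelling cf a b
  dropHead₁ L = record
    { label₁ = tail ∘ label₁ L
    ; label₂ = label₂ L
    ; weighingBy = λ g h g≡0 h≡0 → weighingBy L (g ∘ tail) h (balanced-∘tail g≡0) h≡0
    ; weigh-weighingBy = λ g h g≡0 h≡0 →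
        weigh-weighingBy L (g ∘ tail) h (balanced-∘tail g≡0) h≡0
    }

  dropHead₂ : ∀ {a b} → Labelling cf a (suc b) → Labelling cf a b
  dropHead₂ L = swap (dropHead₁ (swap L))

sumFin-∘toBits : ∀ {k} (g : Vec Bool k → Pan) → Balanced g →
                 sumFin (panVal ∘ g ∘ toBits k) ≡ 0ℤ
sumFin-∘toBits {k} g (mkBalanced g≡0) = trans (sumFin-toBits k (panVal ∘ g)) g≡0

binaryLabelling : ∀ p q → Labelling (uncurry (twoCounterfeits {2 ^ p} {2 ^ q})) p q
binaryLabelling p q = record
  { label₁ = toBits p ∘ proj₁
  ; label₂ = toBits q ∘ proj₂
  ; weighingBy = λ g h g≡0 h≡0 →
      pileWeighing (g ∘ toBits p) (h ∘ toBits q) (sumFin-∘toBits g g≡0) (sumFin-∘toBits h h≡0)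
  ; weigh-weighingBy = λ g h g≡0 h≡0 (i , j) → weigh-pileWeighing (g ∘ toBits p) (h ∘ toBits q)
      (sumFin-∘toBits g g≡0) (sumFin-∘toBits h h≡0) i j
  }

module _ {n} {W : Set} {cf : W → Fin n → Bool} {A : Set} where

  Solves : ∀ {a b m} → Labelling cf a b → (Vec Bool a → Vec Bool b → A) →
           Strategy n A m → Set
  Solves L decode s = ∀ w → run s (cf w) ≡ decode (label₁ L w) (label₂ L w)

  Identification : ∀ {a b} → Labelling cf a b → (Vec Bool a → Vec Bool b → A) → ℕ → Set
  Identification L decode m = Σ (Strategy n A m) (Solves L decode)

  SolvesAfter : ∀ {a b m} → Labelling cf a b → (Vec Bool a → Pan) → (Vec Bool b → Pan) →
                (Outcome → Strategy n A m) → (Vec Bool a → Vec Bool b → A) → Set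
  SolvesAfter L g h next decode = ∀ w →
    run (next (outcomeOf (panVal (g (label₁ L w)) +ℤ panVal (h (label₂ L w))))) (cf w)
      ≡ decode (label₁ L w) (label₂ L w)

  weighThen-identification : ∀ {a b m} (L : Labelling cf a b) g h g≡0 h≡0
    (next : Outcome → Strategy n A m) decode →
    SolvesAfter L g h next decode → Identification L decode (suc m)
  weighThen-identification L g h g≡0 h≡0 next decode byOutcome =
    weighThen (weighingBy L g h g≡0 h≡0) next , λ w →
      trans (cong (λ o → run (next o) (cf w)) (weigh-weighingBy L g h g≡0 h≡0 w)) (byOutcome w)

  mutual
    identify-m-m : ∀ m (L : Labelling cf m m) decode → Identification L decode (suc m)
    identify-m-m zero L decode = answer (decode [] []) , solved
      where
      solved : ∀ w → decode [] [] ≡ decode (label₁ L w) (label₂ L w)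
      solved w with label₁ L w | label₂ L w
      ... | [] | [] = refl
    identify-m-m (suc m) L decode =
      weighThen-identification L byHead byHead balanced-byHead balanced-byHead next decode solved
      where
      sameHead : ∀ b → Identification (dropHead₁ (dropHead₂ L))
                                      (λ x y → decode (b ∷ x) (b ∷ y)) (suc m)
      sameHead b = identify-m-m m (dropHead₁ (dropHead₂ L)) (λ x y → decode (b ∷ x) (b ∷ y))
      oppositeHeads : Identification (swap (dropHead₂ L))
                                     (λ y x → decode x (not (head x) ∷ y)) (suc m)
      oppositeHeads = identify-m-1+m m (swap (dropHead₂ L)) (λ y x → decode x (not (head x) ∷ y))
      next : Outcome → Strategy n A (suc m)
      next muchLess = proj₁ (sameHead false)
      next muchMore = proj₁ (sameHead true)
      next _ = proj₁ oppositeHeads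
      solved : SolvesAfter L byHead byHead next decode
      solved w with label₁ L w | label₂ L w
                  | proj₂ (sameHead false) w | proj₂ (sameHead true) w | proj₂ oppositeHeads w
      ... | false ∷ x | false ∷ y | ok | _ | _ = ok
      ... | false ∷ x | true ∷ y | _ | _ | ok = ok
      ... | true ∷ x | false ∷ y | _ | _ | ok = ok
      ... | true ∷ x | true ∷ y | _ | ok | _ = ok

    identify-m-1+m : ∀ m (L : Labelling cf m (suc m)) decode → Identification L decode (suc m)
    identify-m-1+m zero L decode =
      weighThen-identification L (λ _ → off) byHead balanced-off balanced-byHead next decode solved
      where
      next : Outcome → Strategy n A 0
      next less = answer (decode [] (false ∷ []))
      next _ = answer (decode [] (true ∷ []))
      solved : SolvesAfter L (λ _ → off) byHead next decode
      solved w with label₁ L w | label₂ L w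
      ... | [] | false ∷ [] = refl
      ... | [] | true ∷ [] = refl
    identify-m-1+m (suc m) L decode =
      weighThen-identification L byHead secondIfTrue balanced-byHead balanced-secondIfTrue
                               next decode solved
      where
      secondIfTrue : Vec Bool (suc (suc m)) → Pan
      secondIfTrue = branch (λ _ → off) byHead
      balanced-secondIfTrue : Balanced secondIfTrue
      balanced-secondIfTrue = balanced-branch balanced-off balanced-byHead
      tails : Labelling cf m (suc m)
      tails = dropHead₁ (dropHead₂ L)
      offScale : ∀ b → Identification tails (λ x y → decode (b ∷ x) (false ∷ y)) (suc m)
      offScale b = identify-m-1+m m tails (λ x y → decode (b ∷ x) (false ∷ y))
      sameSide : ∀ b → Identification (dropHead₂ tails)
                                      (λ x y → decode (b ∷ x) (true ∷ b ∷ y)) (suc m)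
      sameSide b = identify-m-m m (dropHead₂ tails) (λ x y → decode (b ∷ x) (true ∷ b ∷ y))
      oppositeSides : Identification (swap (dropHead₂ (dropHead₂ L)))
                                     (λ y x → decode x (true ∷ not (head x) ∷ y)) (suc m)
      oppositeSides = identify-m-1+m m (swap (dropHead₂ (dropHead₂ L)))
                                     (λ y x → decode x (true ∷ not (head x) ∷ y))
      next : Outcome → Strategy n A (suc m)
      next less = proj₁ (offScale false)
      next more = proj₁ (offScale true)
      next muchLess = proj₁ (sameSide false)
      next muchMore = proj₁ (sameSide true)
      next equal = proj₁ oppositeSides
      solved : SolvesAfter L byHead secondIfTrue next decode
      solved w with label₁ L w | label₂ L w | proj₂ (offScale false) w | proj₂ (offScale true) w
                  | proj₂ (sameSide false) w | proj₂ (sameSide true) w | proj₂ oppositeSides w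
      ... | false ∷ x | false ∷ y | ok | _ | _ | _ | _ = ok
      ... | true ∷ x | false ∷ y | _ | ok | _ | _ | _ = ok
      ... | false ∷ x | true ∷ false ∷ y | _ | _ | ok | _ | _ = ok
      ... | true ∷ x | true ∷ true ∷ y | _ | _ | _ | ok | _ = ok
      ... | false ∷ x | true ∷ true ∷ y | _ | _ | _ | _ | ok = ok
      ... | true ∷ x | true ∷ false ∷ y | _ | _ | _ | _ | ok = ok

mainTheorem2 : (k : ℕ) →
    Σ (Strategy (2 ^ k + 2 ^ k) (Fin (2 ^ k) × Fin (2 ^ k)) (suc k))
      (λ s → (i j : Fin (2 ^ k)) → run s (counterfeit k i j) ≡ (i , j))
mainTheorem2 k = proj₁ found , λ i j → trans (proj₂ found (i , j))
  (cong₂ _,_ (fromBits-toBits k i) (fromBits-toBits k j))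
  where
  found = identify-m-m k (binaryLabelling k k) (λ x y → fromBits k x , fromBits k y)
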